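{- For every $n\ge1$, $\mathsf{D}_{\oplus}(\mathrm{MAJ}_n)=n-\mathsf{B}(n)+1$.
   Context: $\mathrm{MAJ}_n\colon\{0,1\}^n\to\{ -1,1\}$ is defined by $\mathrm{MAJ}_n(x)=-1$ iff $\sum_{i=1}^n x_i\ge n/2$. $\mathsf{B}(n)$ is the number of ones in the binary representation of $n$. A parity decision tree is a rooted binary tree whose internal nodes are labeled by parities $\bigoplus_{i\in S}x_i$ ($S\subseteq[n]$), with two outgoing edges labeled by the possible values of the parity, and leaves labeled by $-1$ or $1$; on input $x$ one follows the edges consistent with $x$ and outputs the leaf label. $\mathsf{D}_{\oplus}(f)$ is the minimal depth of a parity decision tree computing $f$. -}

module Defs where

open import Data.Bool using (Bool; true; false; _∧_; _xor_)
open import Data.Nat using (ℕ; zero; suc; _+_; _*_; _≤_; _⊔_)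
open import Data.Nat.DivMod using (_/_; _%_)
open import Data.Vec using (Vec; []; _∷_; zipWith; foldr; count)
open import Data.Fin.Subset using (Subset)
open import Data.Product using (Σ; _×_)
import Relation.Binary.PropositionalEquality
open Relation.Binary.PropositionalEquality using (_≡_)
open import Relation.Nullary.Decidable using (does)
open import Data.Bool.Properties using (T?)
open import Data.Nat.Properties using (_≤?_)

data PM : Set where
  minus1 : PM
  plus1  : PM

-- Inputs x ∈ {0,1}^n as Boolean vectors (true = 1).
Input : ℕ → Set
Input n = Vec Bool n

ones : ∀ {n} → Input n → ℕ
ones x = count T? x

MAJ : (n : ℕ) → Input n → PM
MAJ n x with n ≤? 2 * ones x
... | Relation.Nullary.Decidable.yes _ = minus1
... | Relation.Nullary.Decidable.no  _ = plus1

-- number of ones in the binary representation; the first argument is fuel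
-- (fuel ≥ m suffices since m halves each step)
popcountAux : ℕ → ℕ → ℕ
popcountAux zero    m = 0
popcountAux (suc k) m = m % 2 + popcountAux k (m / 2)

B : ℕ → ℕ
B n = popcountAux n n

parity : ∀ {n} → Subset n → Input n → Bool
parity S x = foldr _ _xor_ false (zipWith _∧_ S x)

data PDT (n : ℕ) : Set where
  leaf : PM → PDT n
  node : Subset n → PDT n → PDT n → PDT n

eval : ∀ {n} → PDT n → Input n → PM
eval (leaf b)     x = b
eval (node S l r) x with parity S x
... | false = eval l x
... | true  = eval r x

depth : ∀ {n} → PDT n → ℕ
depth (leaf _)     = 0
depth (node _ l r) = suc (depth l ⊔ depth r)

Computes : ∀ {n} → PDT n → (Input n → PM) → Set
Computes t f = ∀ x → eval t x ≡ f x

ParityDTDepthIs : ∀ {n} → (Input n → PM) → ℕ → Set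
ParityDTDepthIs {n} f d =
  (Σ (PDT n) λ t → Computes t f × depth t ≡ d)
  × (∀ (t : PDT n) → Computes t f → d ≤ depth t)

private
  open Relation.Binary.PropositionalEquality using (refl)
  _ : B 5 ≡ 2
  _ = refl
  _ : B 8 ≡ 1
  _ = refl

-- Upper bound: feed the n input bits into a binary counter whose occupied slot i holds a parity
-- standing for 2^i input bits known to be equal.  Adding a bit to an occupied slot costs one query,
-- of the xor of the two parities: if they agree they carry into the next slot, otherwise they are
-- one 0 and one 1 and are dropped without affecting the majority.  Tracking the potential
-- B (bits still to read + counter value) shows that a path makes at most n - B(n) such queries;
-- one last query of the highest occupied slot decides the majority, since its weight exceeds all
-- lower weights together.
-- Lower bound: if a parity tree of depth d computes f, every correlation Σₓ [f x = 1] χ_w(x) is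
-- divisible by 2^(n-d), by induction on the tree.  For MAJ_n and w = {1} this correlation is
-- C(n-1, ⌊(n-1)/2⌋), whose 2-adic valuation is B(n) - 1 by Legendre's formula
-- v₂(m!) = m - B(m); hence n - d < B(n).

module Submission where

open import Algebra.Bundles using (CommutativeRing)
open import Data.Bool using (Bool; true; false; not; _∧_; _xor_; if_then_else_)
open import Data.Bool.Properties using (xor-∧-commutativeRing; ∧-distribʳ-xor)
open import Data.Empty using (⊥-elim)
open import Data.Fin using (zero; suc)
open import Data.Fin.Subset using (Subset; ⁅_⁆) renaming (⊥ to ∅)
open import Data.Integer as ℤ using (ℤ; +_; 0ℤ; 1ℤ; -1ℤ)
open import Data.Integer.Divisibility.Signed as ℤ using ()
open import Data.Integer.Properties as ℤ using ()
import Data.Integer.Tactic.RingSolver as ℤ-Solver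
open import Data.List as List using (List; []; _∷_; length; map; tabulate)
open import Data.List.Properties using (length-tabulate; map-tabulate)
open import Data.Maybe using (Maybe; just; nothing)
open import Data.Nat
  using (ℕ; zero; suc; _+_; _*_; _^_; _!; _∸_; _≤_; _<_; _⊔_; z≤n; s≤s; s≤s⁻¹; _≤?_; _≟_)
open import Data.Nat.Combinatorics
  using (_C_; nCk≡n!/k![n-k]!; k![n∸k]!∣n!; nCk≡nC[n∸k]; nCk+nC[k+1]≡[n+1]C[k+1])
open import Data.Nat.DivMod
  using (_/_; _%_; m*n%n≡0; m*n/n≡m; [m+kn]%n≡m%n; +-distrib-/-∣ʳ; m/n<m; m/n*n≡m)
open import Data.Nat.Divisibility using (_∣_; divides; *-monoʳ-∣; ∣-trans)
open import Data.Nat.ListAction using (sum)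
open import Data.Nat.Properties
open import Data.Nat.Tactic.RingSolver using (solve; solve-∀)
open import Data.Product using (∃; ∃-syntax; _,_; proj₁; proj₂)
open import Data.Sum using (_⊎_; inj₁; inj₂; [_,_]′)
open import Data.Vec using ([]; _∷_; zipWith)
open import Function using (_∘_)
open import Relation.Binary.Definitions using (tri<; tri≈; tri>)
open import Relation.Binary.PropositionalEquality
open import Relation.Nullary using (yes; no; ¬_; does)
open import Relation.Nullary.Decidable using (dec-true; dec-false)
open import Algebra.Properties.CommutativeSemigroup
  (CommutativeRing.+-commutativeSemigroup xor-∧-commutativeRing)
  using () renaming (interchange to xor-interchange)
open import Algebra.Properties.CommutativeSemigroup ℤ.+-commutativeSemigroup
  using () renaming (interchange to +-interchange)

open import Defs

_⊕_ : ∀ {n} → Subset n → Subset n → Subset n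
_⊕_ = zipWith _xor_

parity-⊕ : ∀ {n} (S T : Subset n) x → parity (S ⊕ T) x ≡ parity S x xor parity T x
parity-⊕ [] [] [] = refl
parity-⊕ (s ∷ S) (t ∷ T) (b ∷ x) = begin
  ((s xor t) ∧ b) xor parity (S ⊕ T) x                  ≡⟨ cong₂ _xor_ (∧-distribʳ-xor b s t) (parity-⊕ S T x) ⟩
  ((s ∧ b) xor (t ∧ b)) xor (parity S x xor parity T x) ≡⟨ xor-interchange (s ∧ b) (t ∧ b) _ _ ⟩
  ((s ∧ b) xor parity S x) xor ((t ∧ b) xor parity T x) ∎
  where open ≡-Reasoning

parity-∅ : ∀ {n} (x : Input n) → parity ∅ x ≡ false
parity-∅ []      = refl
parity-∅ (_ ∷ x) = parity-∅ x

eval-node : ∀ {n} (S : Subset n) {l r : PDT n} x {b} →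
            parity S x ≡ b → eval (node S l r) x ≡ (if b then eval r x else eval l x)
eval-node S x refl with parity S x
... | false = refl
... | true  = refl

maj : ℕ → ℕ → PM
maj N W with N ≤? 2 * W
... | yes _ = minus1
... | no  _ = plus1

MAJ≡maj : ∀ n x → MAJ n x ≡ maj n (ones x)
MAJ≡maj n x with n ≤? 2 * ones x
... | yes _ = refl
... | no  _ = refl

maj-≤ : ∀ {N W} → N ≤ 2 * W → maj N W ≡ minus1
maj-≤ {N} {W} N≤2W with N ≤? 2 * W
... | yes _    = refl
... | no  N≰2W = ⊥-elim (N≰2W N≤2W)

maj-≰ : ∀ {N W} → ¬ N ≤ 2 * W → maj N W ≡ plus1
maj-≰ {N} {W} N≰2W with N ≤? 2 * W
... | yes N≤2W = ⊥-elim (N≰2W N≤2W)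
... | no  _    = refl

maj-+-balanced : ∀ N W s → maj (N + 2 * s) (W + s) ≡ maj N W
maj-+-balanced N W s with N ≤? 2 * W
... | yes N≤2W = maj-≤ (subst (N + 2 * s ≤_) (sym (*-distribˡ-+ 2 W s)) (+-monoˡ-≤ (2 * s) N≤2W))
... | no  N≰2W = maj-≰ λ le →
  N≰2W (+-cancelʳ-≤ (2 * s) N (2 * W) (subst (N + 2 * s ≤_) (*-distribˡ-+ 2 W s) le))

-- Prepending a low binary digit (c bits, e of them ones) does not change a majority without a tie.
maj-digit : ∀ {N W c e} → N ≢ 2 * W → e ≤ c → c ≤ 1 → maj (c + 2 * N) (e + 2 * W) ≡ maj N W
maj-digit {N} {W} {c} {e} N≢2W e≤c c≤1 with <-cmp N (2 * W)
... | tri≈ _ N≡2W _ = ⊥-elim (N≢2W N≡2W)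
... | tri< N<2W _ _ = trans (maj-≤ below) (sym (maj-≤ (<⇒≤ N<2W)))
  where
  open ≤-Reasoning
  below : c + 2 * N ≤ 2 * (e + 2 * W)
  below = begin
    c + 2 * N            ≤⟨ +-monoˡ-≤ (2 * N) c≤1 ⟩
    1 + 2 * N            ≤⟨ n≤1+n _ ⟩
    2 + 2 * N            ≡⟨ *-suc 2 N ⟨
    2 * (1 + N)          ≤⟨ *-monoʳ-≤ 2 N<2W ⟩
    2 * (2 * W)          ≤⟨ *-monoʳ-≤ 2 (m≤n+m (2 * W) e) ⟩
    2 * (e + 2 * W)      ∎
... | tri> _ _ 2W<N = trans (maj-≰ (<⇒≱ above)) (sym (maj-≰ (<⇒≱ 2W<N)))
  where
  open ≤-Reasoning
  above : 2 * (e + 2 * W) < c + 2 * N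
  above = begin-strict
    2 * (e + 2 * W)        ≡⟨ solve (e List.∷ List.[ W ]) ⟩
    (e + e) + 2 * (2 * W)  ≤⟨ +-monoˡ-≤ _ (+-mono-≤ (≤-trans e≤c c≤1) e≤c) ⟩
    (1 + c) + 2 * (2 * W)  <⟨ n<1+n _ ⟩
    2 + c + 2 * (2 * W)    ≡⟨ solve (c List.∷ List.[ W ]) ⟩
    c + 2 * (1 + 2 * W)    ≤⟨ +-monoʳ-≤ c (*-monoʳ-≤ 2 2W<N) ⟩
    c + 2 * N              ∎

popcountAux-fuel : ∀ {k k′ m} → m ≤ k → m ≤ k′ → popcountAux k m ≡ popcountAux k′ m
popcountAux-fuel {zero}  {zero}    _ _   = refl
popcountAux-fuel {zero}  {suc k′}  z≤n _ = popcountAux-fuel {zero} {k′} z≤n z≤n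
popcountAux-fuel {suc k} {zero}    _ z≤n = popcountAux-fuel {k} {zero} z≤n z≤n
popcountAux-fuel {suc k} {suc k′} {m} m≤1+k m≤1+k′ =
  cong (λ t → m % 2 + t) (popcountAux-fuel (half≤ m≤1+k) (half≤ m≤1+k′))
  where
  half≤ : ∀ {m j} → m ≤ suc j → m / 2 ≤ j
  half≤ {zero}  _       = z≤n
  half≤ {suc m} m≤1+j = s≤s⁻¹ (≤-trans (m/n<m (suc m) 2 ≤-refl) m≤1+j)

B-step : ∀ m → B m ≡ m % 2 + B (m / 2)
B-step zero    = refl
B-step (suc m) = cong (λ t → suc m % 2 + t) (popcountAux-fuel (s≤s⁻¹ (m/n<m (suc m) 2 ≤-refl)) ≤-refl)

[2q]%2≡0 : ∀ q → (2 * q) % 2 ≡ 0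
[2q]%2≡0 q = trans (cong (_% 2) (*-comm 2 q)) (m*n%n≡0 q 2)

[2q]/2≡q : ∀ q → (2 * q) / 2 ≡ q
[2q]/2≡q q = trans (cong (_/ 2) (*-comm 2 q)) (m*n/n≡m q 2)

[1+2q]%2≡1 : ∀ q → (1 + 2 * q) % 2 ≡ 1
[1+2q]%2≡1 q = trans (cong (λ m → (1 + m) % 2) (*-comm 2 q)) ([m+kn]%n≡m%n 1 q 2)

[1+2q]/2≡q : ∀ q → (1 + 2 * q) / 2 ≡ q
[1+2q]/2≡q q = trans (+-distrib-/-∣ʳ 1 (divides q (*-comm 2 q))) ([2q]/2≡q q)

B-double : ∀ q → B (2 * q) ≡ B q
B-double q = trans (B-step (2 * q)) (cong₂ (λ r h → r + B h) ([2q]%2≡0 q) ([2q]/2≡q q))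

B-double+1 : ∀ q → B (1 + 2 * q) ≡ 1 + B q
B-double+1 q = trans (B-step (1 + 2 * q)) (cong₂ (λ r h → r + B h) ([1+2q]%2≡1 q) ([1+2q]/2≡q q))

-- Recursion on Binary n goes from n to ⌊n/2⌋ structurally.
data Binary : ℕ → Set where
  zero : Binary 0
  even : ∀ {q} → Binary q → Binary (2 * q)
  odd  : ∀ {q} → Binary q → Binary (1 + 2 * q)

Binary-suc : ∀ {n} → Binary n → Binary (suc n)
Binary-suc zero         = odd zero
Binary-suc (even b)     = odd b
Binary-suc (odd {q} b)  = subst Binary (*-suc 2 q) (even (Binary-suc b))

binary : ∀ n → Binary n
binary zero    = zero
binary (suc n) = Binary-suc (binary n)

even⊎odd : ∀ n → ∃[ q ] (n ≡ 2 * q ⊎ n ≡ 1 + 2 * q)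
even⊎odd n with binary n
... | zero       = 0 , inj₁ refl
... | even {q} _ = q , inj₁ refl
... | odd  {q} _ = q , inj₂ refl

Bn≤n : ∀ n → B n ≤ n
Bn≤n n = go (binary n)
  where
  go : ∀ {m} → Binary m → B m ≤ m
  go zero         = z≤n
  go (even {q} b) = begin
    B (2 * q)  ≡⟨ B-double q ⟩
    B q        ≤⟨ go b ⟩
    q          ≤⟨ m≤n*m q 2 ⟩
    2 * q      ∎
    where open ≤-Reasoning
  go (odd {q} b)  = begin
    B (1 + 2 * q)  ≡⟨ B-double+1 q ⟩
    1 + B q        ≤⟨ s≤s (go b) ⟩
    1 + q          ≤⟨ s≤s (m≤n*m q 2) ⟩
    1 + 2 * q      ∎
    where open ≤-Reasoning

B[2^a]≡1 : ∀ a → B (2 ^ a) ≡ 1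
B[2^a]≡1 zero    = refl
B[2^a]≡1 (suc a) = trans (B-double (2 ^ a)) (B[2^a]≡1 a)

B[m+2^a]≤1+Bm : ∀ m a → B (m + 2 ^ a) ≤ 1 + B m
B[m+2^a]≤1+Bm m = go (binary m)
  where
  open ≤-Reasoning
  go : ∀ {m} → Binary m → ∀ a → B (m + 2 ^ a) ≤ 1 + B m
  go zero a = ≤-reflexive (B[2^a]≡1 a)
  go (even {q} b) zero = begin
    B (2 * q + 1)  ≡⟨ cong B (+-comm (2 * q) 1) ⟩
    B (1 + 2 * q)  ≡⟨ B-double+1 q ⟩
    1 + B q        ≡⟨ cong suc (B-double q) ⟨
    1 + B (2 * q)  ∎
  go (odd {q} b) zero = begin
    B (1 + 2 * q + 1)  ≡⟨ cong B {x = 1 + 2 * q + 1} {y = 2 * (q + 1)} (solve List.[ q ]) ⟩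
    B (2 * (q + 1))    ≡⟨ B-double (q + 1) ⟩
    B (q + 1)          ≤⟨ go b zero ⟩
    1 + B q            ≡⟨ B-double+1 q ⟨
    B (1 + 2 * q)      ≤⟨ n≤1+n _ ⟩
    1 + B (1 + 2 * q)  ∎
  go (even {q} b) (suc a) = begin
    B (2 * q + 2 * 2 ^ a)  ≡⟨ cong B (*-distribˡ-+ 2 q (2 ^ a)) ⟨
    B (2 * (q + 2 ^ a))    ≡⟨ B-double (q + 2 ^ a) ⟩
    B (q + 2 ^ a)          ≤⟨ go b a ⟩
    1 + B q                ≡⟨ cong suc (B-double q) ⟨
    1 + B (2 * q)          ∎
  go (odd {q} b) (suc a) = begin
    B (1 + 2 * q + 2 * 2 ^ a)  ≡⟨ cong (λ m → B (suc m)) (*-distribˡ-+ 2 q (2 ^ a)) ⟨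
    B (1 + 2 * (q + 2 ^ a))    ≡⟨ B-double+1 (q + 2 ^ a) ⟩
    1 + B (q + 2 ^ a)          ≤⟨ s≤s (go b a) ⟩
    2 + B q                    ≡⟨ cong suc (B-double+1 q) ⟨
    1 + B (1 + 2 * q)          ∎

-- The upper bound: a binary counter of parities

bit : Bool → ℕ
bit false = 0
bit true  = 1

-- Slot i of a counter has weight 2^i: on the current branch of the tree, a slot holding r stands
-- for 2^i input bits that all equal the parity r, so on x the counter represents value S bits of
-- which weight S x are ones.
Counter : ℕ → Set
Counter n = List (Maybe (Subset n))

digit : ∀ {n} → Maybe (Subset n) → ℕ
digit nothing  = 0
digit (just _) = 1

digitAt : ∀ {n} → Input n → Maybe (Subset n) → ℕ
digitAt x nothing  = 0
digitAt x (just r) = bit (parity r x)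

value : ∀ {n} → Counter n → ℕ
value []      = 0
value (m ∷ S) = digit m + 2 * value S

weight : ∀ {n} → Counter n → Input n → ℕ
weight []      x = 0
weight (m ∷ S) x = digitAt x m + 2 * weight S x

onesAmong : ∀ {n} → List (Subset n) → Input n → ℕ
onesAmong rs x = sum (map (λ r → bit (parity r x)) rs)

-- k builds the rest of the tree from the updated counter.  If the slot already holds r₀ we query
-- r₀ ⊕ r: equal parities carry into the next slot, different ones contribute one 0 and one 1,
-- which does not change the majority, and are dropped.
insert : ∀ {n} → Counter n → Subset n → (Counter n → PDT n) → PDT n
insert []             r k = k (just r ∷ [])
insert (nothing ∷ S)  r k = k (just r ∷ S)
insert (just r₀ ∷ S)  r k = node (r₀ ⊕ r) (insert S r₀ (λ S′ → k (nothing ∷ S′))) (k (nothing ∷ S))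

readSlot : ∀ {n} → Maybe (Subset n) → PDT n
readSlot nothing  = leaf minus1
readSlot (just r) = node r (leaf plus1) (leaf minus1)

readTop : ∀ {n} → Counter n → PDT n
readTop []      = leaf minus1
readTop (m ∷ S) with value S
... | zero  = readSlot m
... | suc _ = readTop S

run : ∀ {n} → List (Subset n) → Counter n → PDT n
run []       S = readTop S
run (r ∷ rs) S = insert S r (run rs)

coordinates : ∀ n → List (Subset n)
coordinates n = tabulate ⁅_⁆

majorityTree : ∀ n → PDT n
majorityTree n = run (coordinates n) []

value≡0⇒weight≡0 : ∀ {n} (S : Counter n) x → value S ≡ 0 → weight S x ≡ 0
value≡0⇒weight≡0 []            x _  = refl
value≡0⇒weight≡0 (nothing ∷ S) x eq = cong (2 *_) (value≡0⇒weight≡0 S x (*-cancelˡ-≡ _ 0 2 eq))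
value≡0⇒weight≡0 (just _ ∷ S)  x ()

-- The binary digits of value S are distinct powers of two, so no subset of them sums to half.
value≢2*weight : ∀ {n} (S : Counter n) x → value S ≢ 0 → value S ≢ 2 * weight S x
value≢2*weight []            x v≢0 = v≢0
value≢2*weight (just r ∷ S)  x _   eq = even≢odd (digitAt x (just r) + 2 * weight S x) (value S) (sym eq)
value≢2*weight (nothing ∷ S) x v≢0 eq =
  value≢2*weight S x (λ v≡0 → v≢0 (cong (2 *_) v≡0)) (*-cancelˡ-≡ _ _ 2 eq)

digitAt≤digit : ∀ {n} (x : Input n) m → digitAt x m ≤ digit m
digitAt≤digit x nothing  = z≤n
digitAt≤digit x (just r) with parity r x
... | false = z≤n
... | true  = ≤-refl

digit≤1 : ∀ {n} (m : Maybe (Subset n)) → digit m ≤ 1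
digit≤1 nothing  = z≤n
digit≤1 (just _) = ≤-refl

readSlot-correct : ∀ {n} (m : Maybe (Subset n)) x → eval (readSlot m) x ≡ maj (digit m) (digitAt x m)
readSlot-correct nothing  x = refl
readSlot-correct (just r) x with parity r x
... | false = refl
... | true  = refl

readTop-correct : ∀ {n} (S : Counter n) x → eval (readTop S) x ≡ maj (value S) (weight S x)
readTop-correct []      x = refl
readTop-correct (m ∷ S) x with value S in eq
... | zero rewrite value≡0⇒weight≡0 S x eq =
  trans (readSlot-correct m x) (cong₂ maj (sym (+-identityʳ _)) (sym (+-identityʳ _)))
... | suc v = begin
  eval (readTop S) x                ≡⟨ readTop-correct S x ⟩
  maj (value S) (weight S x)        ≡⟨ maj-digit no-tie (digitAt≤digit x m) (digit≤1 m) ⟨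
  maj (digit m + 2 * value S) w′    ≡⟨ cong (λ v → maj (digit m + 2 * v) w′) eq ⟩
  maj (digit m + 2 * suc v) w′      ∎
  where
  open ≡-Reasoning
  w′ = digitAt x m + 2 * weight S x
  no-tie : value S ≢ 2 * weight S x
  no-tie = value≢2*weight S x (λ v≡0 → 0≢1+n (trans (sym v≡0) eq))

readTop-depth : ∀ {n} (S : Counter n) → depth (readTop S) ≤ 1
readTop-depth []      = z≤n
readTop-depth (m ∷ S) with value S
... | suc _ = readTop-depth S
... | zero with m
...   | nothing = z≤n
...   | just _  = ≤-refl

maj-carry : ∀ E W p v w d → maj (E + p * 2 * (v + 1)) (W + p * 2 * (w + d))
                            ≡ maj (E + p * (1 + 2 * v + 1)) (W + p * (d + 2 * w + d))
maj-carry E W p v w d =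
  cong₂ maj (solve (E List.∷ p List.∷ List.[ v ])) (solve (W List.∷ p List.∷ w List.∷ List.[ d ]))

maj-drop : ∀ E W p v w d₀ d → d₀ + d ≡ 1 →
           maj (E + p * (1 + 2 * v + 1)) (W + p * (d₀ + 2 * w + d)) ≡ maj (E + p * (2 * v)) (W + p * (2 * w))
maj-drop E W p v w d₀ d d₀+d≡1 = begin
  maj (E + p * (1 + 2 * v + 1)) (W + p * (d₀ + 2 * w + d))
    ≡⟨ cong₂ maj (solve (E List.∷ p List.∷ List.[ v ])) (solve (W List.∷ p List.∷ w List.∷ d₀ List.∷ List.[ d ])) ⟩
  maj (E + p * (2 * v) + 2 * p) (W + p * (2 * w) + p * (d₀ + d))
    ≡⟨ cong (λ t → maj (N + 2 * p) (O + t)) (trans (cong (p *_) d₀+d≡1) (*-identityʳ p)) ⟩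
  maj (N + 2 * p) (O + p)
    ≡⟨ maj-+-balanced N O p ⟩
  maj N O
    ∎
  where
  open ≡-Reasoning
  N = E + p * (2 * v)
  O = W + p * (2 * w)

insert-correct : ∀ {n} (S : Counter n) r k (p E W : ℕ) x →
                 (∀ S′ → eval (k S′) x ≡ maj (E + p * value S′) (W + p * weight S′ x)) →
                 eval (insert S r k) x ≡ maj (E + p * (value S + 1)) (W + p * (weight S x + bit (parity r x)))
insert-correct [] r k p E W x hk =
  trans (hk (just r ∷ [])) (cong (λ t → maj (E + p * 1) (W + p * t)) (+-identityʳ _))
insert-correct (nothing ∷ S) r k p E W x hk =
  trans (hk (just r ∷ S)) (cong₂ (λ s t → maj (E + p * s) (W + p * t)) (+-comm 1 _) (+-comm (bit (parity r x)) _))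
insert-correct (just r₀ ∷ S) r k p E W x hk
  with parity r₀ x | parity r x | parity-⊕ r₀ r x
     | insert-correct S r₀ (λ S′ → k (nothing ∷ S′)) (p * 2) E W x
         (λ S′ → trans (hk (nothing ∷ S′))
                       (sym (cong₂ (λ s t → maj (E + s) (W + t)) (*-assoc p 2 _) (*-assoc p 2 _))))
     | hk (nothing ∷ S)
... | false | false | queried | carried | _ =
  trans (eval-node (r₀ ⊕ r) x queried) (trans carried (maj-carry E W p (value S) (weight S x) 0))
... | true  | true  | queried | carried | _ =
  trans (eval-node (r₀ ⊕ r) x queried) (trans carried (maj-carry E W p (value S) (weight S x) 1))
... | false | true  | queried | _ | dropped =
  trans (eval-node (r₀ ⊕ r) x queried) (trans dropped (sym (maj-drop E W p (value S) (weight S x) 0 1 refl)))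
... | true  | false | queried | _ | dropped =
  trans (eval-node (r₀ ⊕ r) x queried) (trans dropped (sym (maj-drop E W p (value S) (weight S x) 1 0 refl)))

insert-depth : ∀ {n} (S : Counter n) r k a (E c : ℕ) →
               (∀ S′ → depth (k S′) + B (E + 2 ^ a * value S′) ≤ c + B (value S′)) →
               depth (insert S r k) + B (E + 2 ^ a * (value S + 1)) ≤ c + B (value S) + 1
insert-depth [] r k a E c hk = ≤-trans (hk (just r ∷ [])) (≤-reflexive (cong (_+ 1) (sym (+-identityʳ c))))
insert-depth (nothing ∷ S) r k a E c hk = begin
  depth K + B (E + 2 ^ a * (2 * v + 1))  ≡⟨ cong (λ t → depth K + B (E + 2 ^ a * t)) (+-comm (2 * v) 1) ⟩
  depth K + B (E + 2 ^ a * (1 + 2 * v))  ≤⟨ hk (just r ∷ S) ⟩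
  c + B (1 + 2 * v)                      ≡⟨ cong (λ t → c + t) (trans (B-double+1 v) (+-comm 1 (B v))) ⟩
  c + (B v + 1)                          ≡⟨ +-assoc c (B v) 1 ⟨
  c + B v + 1                            ≡⟨ cong (λ t → c + t + 1) (B-double v) ⟨
  c + B (2 * v) + 1                      ∎
  where
  open ≤-Reasoning
  K = k (just r ∷ S)
  v = value S
insert-depth (just r₀ ∷ S) r k a E c hk = begin
  suc (depth L ⊔ depth R) + B (E + 2 ^ a * (1 + 2 * v + 1))  ≡⟨ cong (λ t → suc (depth L ⊔ depth R) + B (E + t))
                                                                      (double-slot (2 ^ a) v) ⟩
  suc (depth L ⊔ depth R) + Y                                 ≡⟨ cong suc (+-distribʳ-⊔ Y (depth L) (depth R)) ⟩
  suc ((depth L + Y) ⊔ (depth R + Y))                         ≤⟨ s≤s (⊔-lub carried dropped) ⟩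
  suc (c + B v + 1)                                           ≡⟨ cong (_+ 1) (+-suc c (B v)) ⟨
  c + suc (B v) + 1                                           ≡⟨ cong (λ t → c + t + 1) (B-double+1 v) ⟨
  c + B (1 + 2 * v) + 1                                       ∎
  where
  open ≤-Reasoning
  double-slot : ∀ p v → p * (1 + 2 * v + 1) ≡ 2 * p * (v + 1)
  double-slot = solve-∀
  double : ∀ p y → p * (2 * y) ≡ 2 * p * y
  double = solve-∀
  split : ∀ E q v → E + q * (v + 1) ≡ E + q * v + q
  split = solve-∀
  L = insert S r₀ (λ S′ → k (nothing ∷ S′))
  R = k (nothing ∷ S)
  v = value S
  Y = B (E + 2 ^ suc a * (v + 1))
  halve : ∀ S′ → depth (k (nothing ∷ S′)) + B (E + 2 ^ suc a * value S′) ≤ c + B (value S′)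
  halve S′ = subst₂ _≤_ (cong (λ t → depth (k (nothing ∷ S′)) + B (E + t)) (double (2 ^ a) (value S′)))
                        (cong (λ t → c + t) (B-double (value S′))) (hk (nothing ∷ S′))
  carried : depth L + Y ≤ c + B v + 1
  carried = insert-depth S r₀ (λ S′ → k (nothing ∷ S′)) (suc a) E c halve
  dropped : depth R + Y ≤ c + B v + 1
  dropped = begin
    depth R + Y                                  ≡⟨ cong (λ t → depth R + B t) (split E (2 ^ suc a) v) ⟩
    depth R + B (E + 2 ^ suc a * v + 2 ^ suc a)  ≤⟨ +-monoʳ-≤ (depth R) (B[m+2^a]≤1+Bm (E + 2 ^ suc a * v) (suc a)) ⟩
    depth R + suc (B (E + 2 ^ suc a * v))        ≡⟨ +-suc (depth R) _ ⟩
    suc (depth R + B (E + 2 ^ suc a * v))        ≤⟨ s≤s (halve S) ⟩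
    suc (c + B v)                                ≡⟨ +-comm 1 (c + B v) ⟩
    c + B v + 1                                  ∎

run-correct : ∀ {n} (rs : List (Subset n)) S x →
              eval (run rs S) x ≡ maj (length rs + value S) (onesAmong rs x + weight S x)
run-correct []       S x = readTop-correct S x
run-correct (r ∷ rs) S x =
  trans (insert-correct S r (run rs) 1 (length rs) (onesAmong rs x) x hk)
        (cong₂ maj (reorder (length rs) (value S)) (reorder′ (onesAmong rs x) (weight S x) (bit (parity r x))))
  where
  hk : ∀ S′ → eval (run rs S′) x ≡ maj (length rs + 1 * value S′) (onesAmong rs x + 1 * weight S′ x)
  hk S′ = trans (run-correct rs S′ x)
                (sym (cong₂ (λ s t → maj (length rs + s) (onesAmong rs x + t)) (*-identityˡ _) (*-identityˡ _)))
  reorder : ∀ L v → L + 1 * (v + 1) ≡ suc L + v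
  reorder = solve-∀
  reorder′ : ∀ O w b → O + 1 * (w + b) ≡ b + O + w
  reorder′ = solve-∀

run-depth : ∀ {n} (rs : List (Subset n)) S →
            depth (run rs S) + B (length rs + value S) ≤ length rs + B (value S) + 1
run-depth []       S = ≤-trans (+-monoˡ-≤ (B (value S)) (readTop-depth S)) (≤-reflexive (+-comm 1 (B (value S))))
run-depth (r ∷ rs) S = subst₂ _≤_
  (cong (λ t → depth (run (r ∷ rs) S) + B t) (reorder (length rs) (value S)))
  (cong (λ t → t + B (value S) + 1) (+-comm (length rs) 1))
  (insert-depth S r (run rs) 0 (length rs) (length rs + 1) hk)
  where
  reorder : ∀ L v → L + 1 * (v + 1) ≡ suc L + v
  reorder = solve-∀
  reorder′ : ∀ L b → L + b + 1 ≡ L + 1 + b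
  reorder′ = solve-∀
  hk : ∀ S′ → depth (run rs S′) + B (length rs + 1 * value S′) ≤ length rs + 1 + B (value S′)
  hk S′ = subst₂ _≤_ (cong (λ t → depth (run rs S′) + B (length rs + t)) (sym (*-identityˡ _)))
                     (reorder′ (length rs) (B (value S′))) (run-depth rs S′)

onesAmong-coordinates : ∀ {n} (x : Input n) → onesAmong (coordinates n) x ≡ ones x
onesAmong-coordinates x = trans (cong sum (map-tabulate ⁅_⁆ (λ r → bit (parity r x)))) (go x)
  where
  go : ∀ {n} (x : Input n) → sum (tabulate (λ i → bit (parity ⁅ i ⁆ x))) ≡ ones x
  go []          = refl
  go (false ∷ x) rewrite parity-∅ x = go x
  go (true  ∷ x) rewrite parity-∅ x = cong suc (go x)

majorityTree-correct : ∀ n → Computes (majorityTree n) (MAJ n)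
majorityTree-correct n x = begin
  eval (run (coordinates n) []) x                                       ≡⟨ run-correct (coordinates n) [] x ⟩
  maj (length (coordinates n) + 0) (onesAmong (coordinates n) x + 0)
    ≡⟨ cong₂ maj (trans (+-identityʳ _) (length-tabulate ⁅_⁆)) (trans (+-identityʳ _) (onesAmong-coordinates x)) ⟩
  maj n (ones x)                                                        ≡⟨ MAJ≡maj n x ⟨
  MAJ n x                                                               ∎
  where open ≡-Reasoning

majorityTree-depth : ∀ n → depth (majorityTree n) ≤ n ∸ B n + 1
majorityTree-depth n =
  subst (depth (majorityTree n) ≤_) (+-∸-comm 1 (Bn≤n n)) (m+n≤o⇒m≤o∸n (depth (majorityTree n)) bound)
  where
  bound : depth (majorityTree n) + B n ≤ n + 1
  bound with run-depth (coordinates n) []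
  ... | h rewrite +-identityʳ (length (coordinates n)) | length-tabulate {n = n} ⁅_⁆ = h

-- 2-adic valuations of factorials and central binomial coefficients

-- A data type rather than a Σ-type, so that a and k are recovered by unification.
data Val₂ (a k : ℕ) : Set where
  val₂ : ∀ u → a ≡ 2 ^ k * (1 + 2 * u) → Val₂ a k

Val₂-odd : ∀ u → Val₂ (1 + 2 * u) 0
Val₂-odd u = val₂ u (sym (+-identityʳ _))

Val₂-* : ∀ {a b i j} → Val₂ a i → Val₂ b j → Val₂ (a * b) (i + j)
Val₂-* {i = i} {j} (val₂ u refl) (val₂ v refl) = val₂ (u + v + 2 * u * v) (begin
  2 ^ i * (1 + 2 * u) * (2 ^ j * (1 + 2 * v))     ≡⟨ regroup (2 ^ i) (2 ^ j) u v ⟩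
  2 ^ i * 2 ^ j * (1 + 2 * (u + v + 2 * u * v))   ≡⟨ cong (_* _) (^-distribˡ-+-* 2 i j) ⟨
  2 ^ (i + j) * (1 + 2 * (u + v + 2 * u * v))     ∎)
  where
  open ≡-Reasoning
  regroup : ∀ P Q u v → P * (1 + 2 * u) * (Q * (1 + 2 * v)) ≡ P * Q * (1 + 2 * (u + v + 2 * u * v))
  regroup = solve-∀

Val₂-unique : ∀ {a i j} → Val₂ a i → Val₂ a j → i ≡ j
Val₂-unique {i = i} {j} (val₂ u eq₁) (val₂ v eq₂) = go i j u v (trans (sym eq₁) eq₂)
  where
  go : ∀ i j u v → 2 ^ i * (1 + 2 * u) ≡ 2 ^ j * (1 + 2 * v) → i ≡ j
  go zero    zero    u v _  = refl
  go zero    (suc j) u v eq = ⊥-elim (even≢odd (2 ^ j * (1 + 2 * v)) u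
                                       (sym (trans (sym (+-identityʳ _)) (trans eq (*-assoc 2 (2 ^ j) _)))))
  go (suc i) zero    u v eq = ⊥-elim (even≢odd (2 ^ i * (1 + 2 * u)) v
                                       (trans (sym (*-assoc 2 (2 ^ i) _)) (trans eq (+-identityʳ _))))
  go (suc i) (suc j) u v eq =
    cong suc (go i j u v (*-cancelˡ-≡ _ _ 2 (trans (sym (*-assoc 2 (2 ^ i) _)) (trans eq (*-assoc 2 (2 ^ j) _)))))

Val₂⇒¬2^[1+k]∣ : ∀ {a k} → Val₂ a k → ¬ 2 ^ suc k ∣ a
Val₂⇒¬2^[1+k]∣ {k = k} (val₂ u refl) (divides q eq) =
  even≢odd q u (sym (*-cancelˡ-≡ _ _ (2 ^ k) {{m^n≢0 2 k}} (trans eq (swap q (2 ^ k)))))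
  where
  swap : ∀ q P → q * (2 * P) ≡ P * (2 * q)
  swap = solve-∀

Val₂-exists : ∀ a → a ≢ 0 → ∃ (Val₂ a)
Val₂-exists a = go (binary a)
  where
  go : ∀ {a} → Binary a → a ≢ 0 → ∃ (Val₂ a)
  go zero         a≢0 = ⊥-elim (a≢0 refl)
  go (odd {q} _)  _   = 0 , Val₂-odd q
  go (even {q} b) a≢0 with go b (λ q≡0 → a≢0 (cong (2 *_) q≡0))
  ... | k , val₂ u refl = suc k , val₂ u (sym (*-assoc 2 (2 ^ k) _))

oddProduct : ℕ → ℕ
oddProduct zero    = 1
oddProduct (suc q) = (1 + 2 * q) * oddProduct q

Val₂-oddProduct : ∀ q → Val₂ (oddProduct q) 0
Val₂-oddProduct zero    = Val₂-odd 0
Val₂-oddProduct (suc q) = Val₂-* (Val₂-odd q) (Val₂-oddProduct q)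

[2q]!≡2^q*q!*oddProduct : ∀ q → (2 * q) ! ≡ 2 ^ q * q ! * oddProduct q
[2q]!≡2^q*q!*oddProduct zero    = refl
[2q]!≡2^q*q!*oddProduct (suc q) = begin
  (2 * suc q) !
    ≡⟨ cong _! (*-suc 2 q) ⟩
  (2 + 2 * q) * ((1 + 2 * q) * (2 * q) !)
    ≡⟨ cong (λ f → (2 + 2 * q) * ((1 + 2 * q) * f)) ([2q]!≡2^q*q!*oddProduct q) ⟩
  (2 + 2 * q) * ((1 + 2 * q) * (2 ^ q * q ! * oddProduct q))
    ≡⟨ regroup q (2 ^ q) (q !) (oddProduct q) ⟩
  2 ^ suc q * (suc q) ! * oddProduct (suc q)
    ∎
  where
  open ≡-Reasoning
  regroup : ∀ q P F O → (2 + 2 * q) * ((1 + 2 * q) * (P * F * O)) ≡ 2 * P * (F + q * F) * ((1 + 2 * q) * O)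
  regroup = solve-∀

Val₂-! : ∀ m → Val₂ (m !) (m ∸ B m)
Val₂-! m = go (binary m)
  where
  double : ∀ {q} → Val₂ (q !) (q ∸ B q) → Val₂ ((2 * q) !) (2 * q ∸ B q)
  double {q} v = subst₂ Val₂ (sym ([2q]!≡2^q*q!*oddProduct q)) exponent
                   (Val₂-* (Val₂-* (val₂ 0 (sym (*-identityʳ (2 ^ q)))) v) (Val₂-oddProduct q))
    where
    exponent : q + (q ∸ B q) + 0 ≡ 2 * q ∸ B q
    exponent = begin
      q + (q ∸ B q) + 0  ≡⟨ +-identityʳ _ ⟩
      q + (q ∸ B q)      ≡⟨ +-∸-assoc q (Bn≤n q) ⟨
      q + q ∸ B q        ≡⟨ cong (λ t → q + t ∸ B q) (+-identityʳ q) ⟨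
      2 * q ∸ B q        ∎
      where open ≡-Reasoning
  go : ∀ {m} → Binary m → Val₂ (m !) (m ∸ B m)
  go zero         = val₂ 0 refl
  go (even {q} b) = subst (λ k → Val₂ ((2 * q) !) (2 * q ∸ k)) (sym (B-double q)) (double {q} (go b))
  go (odd {q} b)  = subst (λ k → Val₂ ((1 + 2 * q) !) (1 + 2 * q ∸ k)) (sym (B-double+1 q))
                          (Val₂-* (Val₂-odd q) (double {q} (go b)))

nCk*k!*[n∸k]!≡n! : ∀ {n k} → k ≤ n → (n C k) * (k ! * (n ∸ k) !) ≡ n !
nCk*k!*[n∸k]!≡n! {n} {k} k≤n =
  trans (cong (_* (k ! * (n ∸ k) !)) (nCk≡n!/k![n-k]! k≤n)) (m/n*n≡m (k![n∸k]!∣n! k≤n))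
  where instance _ = k !* (n ∸ k) !≢0

Val₂-central : ∀ m → Val₂ ((2 * m) C m) (B m)
Val₂-central m = subst (Val₂ ((2 * m) C m)) c≡Bm val-c
  where
  v = m ∸ B m
  product : ((2 * m) C m) * (m ! * m !) ≡ (2 * m) !
  product = subst (λ k → ((2 * m) C m) * (m ! * k !) ≡ (2 * m) !)
                  (trans (m+n∸m≡n m (m + 0)) (+-identityʳ m)) (nCk*k!*[n∸k]!≡n! (m≤n*m m 2))
  C≢0 : (2 * m) C m ≢ 0
  C≢0 C≡0 = <⇒≢ (1≤n! (2 * m)) (sym (trans (sym product) (cong (_* (m ! * m !)) C≡0)))
  c = proj₁ (Val₂-exists ((2 * m) C m) C≢0)
  val-c : Val₂ ((2 * m) C m) c
  val-c = proj₂ (Val₂-exists ((2 * m) C m) C≢0)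
  via-product : Val₂ ((2 * m) !) (c + (v + v))
  via-product = subst (λ a → Val₂ a (c + (v + v))) product (Val₂-* val-c (Val₂-* (Val₂-! m) (Val₂-! m)))
  via-legendre : Val₂ ((2 * m) !) (2 * m ∸ B m)
  via-legendre = subst (λ k → Val₂ ((2 * m) !) (2 * m ∸ k)) (B-double m) (Val₂-! (2 * m))
  c≡Bm : c ≡ B m
  c≡Bm = +-cancelˡ-≡ (v + v) c (B m) (begin
    v + v + c          ≡⟨ +-comm (v + v) c ⟩
    c + (v + v)        ≡⟨ Val₂-unique via-product via-legendre ⟩
    2 * m ∸ B m        ≡⟨ cong (λ t → m + t ∸ B m) (+-identityʳ m) ⟩
    m + m ∸ B m        ≡⟨ +-∸-assoc m (Bn≤n m) ⟩
    m + v              ≡⟨ cong (_+ v) (m∸n+n≡m (Bn≤n m)) ⟨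
    v + B m + v        ≡⟨ regroup v (B m) ⟩
    v + v + B m        ∎)
    where
    open ≡-Reasoning
    regroup : ∀ v b → v + b + v ≡ v + v + b
    regroup = solve-∀

[2q+2]C[q+1]≡2*[2q+1]Cq : ∀ q → (2 * suc q) C suc q ≡ 2 * ((1 + 2 * q) C q)
[2q+2]C[q+1]≡2*[2q+1]Cq q = begin
  (2 * suc q) C suc q          ≡⟨ cong (_C suc q) (*-suc 2 q) ⟩
  (2 + 2 * q) C suc q          ≡⟨ nCk+nC[k+1]≡[n+1]C[k+1] (1 + 2 * q) q ⟨
  X + (1 + 2 * q) C suc q      ≡⟨ cong (λ t → X + t) symmetric ⟩
  X + X                        ≡⟨ cong (λ t → X + t) (+-identityʳ X) ⟨
  2 * X                        ∎
  where
  open ≡-Reasoning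
  X = (1 + 2 * q) C q
  symmetric : (1 + 2 * q) C suc q ≡ X
  symmetric = trans (nCk≡nC[n∸k] (s≤s (m≤n*m q 2)))
                    (cong ((1 + 2 * q) C_) (trans (m+n∸m≡n q (q + 0)) (+-identityʳ q)))

¬2^B∣binomial : ∀ n q → n ≡ 2 * q ⊎ n ≡ 1 + 2 * q → ¬ 2 ^ B (suc n) ∣ n C q
¬2^B∣binomial _ q (inj₁ refl) =
  subst (λ b → ¬ 2 ^ b ∣ (2 * q) C q) (sym (B-double+1 q)) (Val₂⇒¬2^[1+k]∣ (Val₂-central q))
¬2^B∣binomial _ q (inj₂ refl) dvd = Val₂⇒¬2^[1+k]∣ (Val₂-central (suc q))
  (subst₂ (λ b X → 2 ^ suc b ∣ X) B[2q+2]≡B[q+1] (sym ([2q+2]C[q+1]≡2*[2q+1]Cq q)) (*-monoʳ-∣ 2 dvd))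
  where
  B[2q+2]≡B[q+1] : B (2 + 2 * q) ≡ B (suc q)
  B[2q+2]≡B[q+1] = trans (cong B (sym (*-suc 2 q))) (B-double (suc q))

-- The lower bound: granularity of parity decision trees

^-monoʳ-∣ : ∀ m {a b} → a ≤ b → m ^ a ∣ m ^ b
^-monoʳ-∣ m {a} {b} a≤b = divides (m ^ (b ∸ a)) (begin
  m ^ b                ≡⟨ cong (m ^_) (m∸n+n≡m a≤b) ⟨
  m ^ (b ∸ a + a)      ≡⟨ ^-distribˡ-+-* m (b ∸ a) a ⟩
  m ^ (b ∸ a) * m ^ a  ∎)
  where open ≡-Reasoning

∑ : ∀ {n} → (Input n → ℤ) → ℤ
∑ {zero}  f = f []
∑ {suc n} f = ∑ (λ x → f (false ∷ x)) ℤ.+ ∑ (λ x → f (true ∷ x))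

∑-cong : ∀ {n} {f g : Input n → ℤ} → (∀ x → f x ≡ g x) → ∑ f ≡ ∑ g
∑-cong {zero}  f≗g = f≗g []
∑-cong {suc n} f≗g = cong₂ ℤ._+_ (∑-cong (λ x → f≗g (false ∷ x))) (∑-cong (λ x → f≗g (true ∷ x)))

∑-+ : ∀ {n} (f g : Input n → ℤ) → ∑ (λ x → f x ℤ.+ g x) ≡ ∑ f ℤ.+ ∑ g
∑-+ {zero}  f g = refl
∑-+ {suc n} f g = trans (cong₂ ℤ._+_ (∑-+ (λ x → f (false ∷ x)) (λ x → g (false ∷ x)))
                                     (∑-+ (λ x → f (true ∷ x)) (λ x → g (true ∷ x))))
                        (+-interchange (∑ (λ x → f (false ∷ x))) (∑ (λ x → g (false ∷ x)))
                                       (∑ (λ x → f (true ∷ x))) (∑ (λ x → g (true ∷ x))))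

∑-* : ∀ {n} c (f : Input n → ℤ) → ∑ (λ x → c ℤ.* f x) ≡ c ℤ.* ∑ f
∑-* {zero}  c f = refl
∑-* {suc n} c f = trans (cong₂ ℤ._+_ (∑-* c (λ x → f (false ∷ x))) (∑-* c (λ x → f (true ∷ x))))
                        (sym (ℤ.*-distribˡ-+ c (∑ (λ x → f (false ∷ x))) (∑ (λ x → f (true ∷ x)))))

∑-neg : ∀ {n} (f : Input n → ℤ) → ∑ (λ x → ℤ.- f x) ≡ ℤ.- ∑ f
∑-neg {zero}  f = refl
∑-neg {suc n} f = trans (cong₂ ℤ._+_ (∑-neg (λ x → f (false ∷ x))) (∑-neg (λ x → f (true ∷ x))))
                        (sym (ℤ.neg-distrib-+ (∑ (λ x → f (false ∷ x))) (∑ (λ x → f (true ∷ x)))))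

∑-0 : ∀ {n} → ∑ {n} (λ _ → 0ℤ) ≡ 0ℤ
∑-0 {zero}  = refl
∑-0 {suc n} = cong₂ ℤ._+_ (∑-0 {n}) (∑-0 {n})

sign : Bool → ℤ
sign false = 1ℤ
sign true  = -1ℤ

sign-xor : ∀ a b → sign (a xor b) ≡ sign a ℤ.* sign b
sign-xor false false = refl
sign-xor false true  = refl
sign-xor true  false = refl
sign-xor true  true  = refl

sign-not : ∀ a → sign (not a) ≡ ℤ.- sign a
sign-not false = refl
sign-not true  = refl

χ : ∀ {n} → Subset n → Input n → ℤ
χ S x = sign (parity S x)

χ-⊕ : ∀ {n} (S T : Subset n) x → χ (S ⊕ T) x ≡ χ S x ℤ.* χ T x
χ-⊕ S T x = trans (cong sign (parity-⊕ S T x)) (sign-xor (parity S x) (parity T x))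

2^n∣∑χ : ∀ {n} (w : Subset n) → + (2 ^ n) ℤ.∣ ∑ (χ w)
2^n∣∑χ []          = ℤ.divides (∑ (χ [])) (sym (ℤ.*-identityʳ _))
2^n∣∑χ {suc n} (false ∷ w) =
  subst₂ ℤ._∣_ (sym (ℤ.pos-* 2 (2 ^ n))) (twice (∑ (χ w))) (ℤ.*-monoʳ-∣ (+ 2) (2^n∣∑χ w))
  where
  twice : ∀ a → + 2 ℤ.* a ≡ a ℤ.+ a
  twice = ℤ-Solver.solve-∀
2^n∣∑χ {suc n} (true ∷ w)  = subst (+ (2 ^ suc n) ℤ.∣_) (sym cancels) (ℤ.divides 0ℤ refl)
  where
  cancels : ∑ (χ w) ℤ.+ ∑ (λ x → sign (not (parity w x))) ≡ 0ℤ
  cancels = begin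
    ∑ (χ w) ℤ.+ ∑ (λ x → sign (not (parity w x)))  ≡⟨ cong (ℤ._+_ (∑ (χ w))) (∑-cong (sign-not ∘ parity w)) ⟩
    ∑ (χ w) ℤ.+ ∑ (λ x → ℤ.- χ w x)                ≡⟨ cong (ℤ._+_ (∑ (χ w))) (∑-neg (χ w)) ⟩
    ∑ (χ w) ℤ.- ∑ (χ w)                            ≡⟨ ℤ.+-inverseʳ (∑ (χ w)) ⟩
    0ℤ                                             ∎
    where open ≡-Reasoning

indicator : PM → ℤ
indicator minus1 = 0ℤ
indicator plus1  = 1ℤ

correlation : ∀ {n} → (Input n → PM) → Subset n → ℤ
correlation f w = ∑ (λ x → indicator (f x) ℤ.* χ w x)

-- The node's indicator is ((1 + χ S) l + (1 - χ S) r) / 2, and χ S χ w = χ (S ⊕ w).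
node-split : ∀ {n} (S : Subset n) (l r : PDT n) w x →
             + 2 ℤ.* (indicator (eval (node S l r) x) ℤ.* χ w x)
             ≡ (indicator (eval l x) ℤ.* χ w x ℤ.+ indicator (eval l x) ℤ.* χ (S ⊕ w) x)
               ℤ.+ (indicator (eval r x) ℤ.* χ w x ℤ.- indicator (eval r x) ℤ.* χ (S ⊕ w) x)
node-split S l r w x rewrite χ-⊕ S w x with parity S x
... | false = left (indicator (eval l x)) (indicator (eval r x)) (χ w x)
  where
  left : ∀ L R c → + 2 ℤ.* (L ℤ.* c)
                   ≡ (L ℤ.* c ℤ.+ L ℤ.* (1ℤ ℤ.* c)) ℤ.+ (R ℤ.* c ℤ.- R ℤ.* (1ℤ ℤ.* c))
  left = ℤ-Solver.solve-∀
... | true  = right (indicator (eval l x)) (indicator (eval r x)) (χ w x)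
  where
  right : ∀ L R c → + 2 ℤ.* (R ℤ.* c)
                    ≡ (L ℤ.* c ℤ.+ L ℤ.* (-1ℤ ℤ.* c)) ℤ.+ (R ℤ.* c ℤ.- R ℤ.* (-1ℤ ℤ.* c))
  right = ℤ-Solver.solve-∀

2^k∣2z⇒2^[k∸1]∣z : ∀ k {z} → + (2 ^ k) ℤ.∣ + 2 ℤ.* z → + (2 ^ (k ∸ 1)) ℤ.∣ z
2^k∣2z⇒2^[k∸1]∣z zero    {z} _ = ℤ.divides z (sym (ℤ.*-identityʳ z))
2^k∣2z⇒2^[k∸1]∣z (suc k) dvd = ℤ.*-cancelˡ-∣ (+ 2) (subst (ℤ._∣ _) (ℤ.pos-* 2 (2 ^ k)) dvd)

2^[n∸depth]∣correlation : ∀ {n} (t : PDT n) w → + (2 ^ (n ∸ depth t)) ℤ.∣ correlation (eval t) w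
2^[n∸depth]∣correlation {n} (leaf c) w =
  subst (+ (2 ^ n) ℤ.∣_) (sym (∑-* (indicator c) (χ w))) (ℤ.∣n⇒∣m*n (indicator c) (2^n∣∑χ w))
2^[n∸depth]∣correlation {n} (node S l r) w =
  subst (λ k → + (2 ^ k) ℤ.∣ corr (node S l r) w) (trans (∸-+-assoc n d 1) (cong (n ∸_) (+-comm d 1)))
        (2^k∣2z⇒2^[k∸1]∣z (n ∸ d) (subst (+ (2 ^ (n ∸ d)) ℤ.∣_) (sym doubled) divisible))
  where
  corr : PDT n → Subset n → ℤ
  corr t = correlation (eval t)
  d = depth l ⊔ depth r
  weaken : ∀ e {z} → e ≤ d → + (2 ^ (n ∸ e)) ℤ.∣ z → + (2 ^ (n ∸ d)) ℤ.∣ z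
  weaken e e≤d = ℤ.∣-trans (ℤ.∣ᵤ⇒∣ (^-monoʳ-∣ 2 (∸-monoʳ-≤ n e≤d)))
  left : ∀ w → + (2 ^ (n ∸ d)) ℤ.∣ corr l w
  left w = weaken (depth l) (m≤m⊔n (depth l) (depth r)) (2^[n∸depth]∣correlation l w)
  right : ∀ w → + (2 ^ (n ∸ d)) ℤ.∣ corr r w
  right w = weaken (depth r) (m≤n⊔m (depth l) (depth r)) (2^[n∸depth]∣correlation r w)
  doubled : + 2 ℤ.* corr (node S l r) w ≡ (corr l w ℤ.+ corr l (S ⊕ w)) ℤ.+ (corr r w ℤ.- corr r (S ⊕ w))
  doubled = begin
    + 2 ℤ.* ∑ (λ x → indicator (eval (node S l r) x) ℤ.* χ w x)
      ≡⟨ ∑-* (+ 2) (λ x → indicator (eval (node S l r) x) ℤ.* χ w x) ⟨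
    ∑ (λ x → + 2 ℤ.* (indicator (eval (node S l r) x) ℤ.* χ w x))
      ≡⟨ ∑-cong (node-split S l r w) ⟩
    ∑ (λ x → (a x ℤ.+ b x) ℤ.+ (c x ℤ.- e x))
      ≡⟨ ∑-+ (λ x → a x ℤ.+ b x) (λ x → c x ℤ.- e x) ⟩
    ∑ (λ x → a x ℤ.+ b x) ℤ.+ ∑ (λ x → c x ℤ.- e x)
      ≡⟨ cong₂ ℤ._+_ (∑-+ a b) (trans (∑-+ c (λ x → ℤ.- e x)) (cong (ℤ._+_ (∑ c)) (∑-neg e))) ⟩
    (∑ a ℤ.+ ∑ b) ℤ.+ (∑ c ℤ.- ∑ e)
      ∎
    where
    open ≡-Reasoning
    a = λ x → indicator (eval l x) ℤ.* χ w x
    b = λ x → indicator (eval l x) ℤ.* χ (S ⊕ w) x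
    c = λ x → indicator (eval r x) ℤ.* χ w x
    e = λ x → indicator (eval r x) ℤ.* χ (S ⊕ w) x
  divisible : + (2 ^ (n ∸ d)) ℤ.∣ (corr l w ℤ.+ corr l (S ⊕ w)) ℤ.+ (corr r w ℤ.- corr r (S ⊕ w))
  divisible = ℤ.∣m∣n⇒∣m+n (ℤ.∣m∣n⇒∣m+n (left w) (left (S ⊕ w))) (ℤ.∣m∣n⇒∣m-n (right w) (right (S ⊕ w)))

𝟙 : Bool → ℤ
𝟙 false = 0ℤ
𝟙 true  = 1ℤ

∑𝟙[ones≡j]≡nCj : ∀ n j → ∑ {n} (λ x → 𝟙 (does (ones x ≟ j))) ≡ + (n C j)
∑𝟙[ones≡j]≡nCj zero    zero    = refl
∑𝟙[ones≡j]≡nCj zero    (suc j) = refl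
∑𝟙[ones≡j]≡nCj (suc n) zero    = cong₂ ℤ._+_ (∑𝟙[ones≡j]≡nCj n zero) (∑-0 {n})
∑𝟙[ones≡j]≡nCj (suc n) (suc j) = begin
  ∑ {n} (λ x → 𝟙 (does (ones x ≟ suc j))) ℤ.+ ∑ {n} (λ x → 𝟙 (does (ones x ≟ j)))
    ≡⟨ cong₂ ℤ._+_ (∑𝟙[ones≡j]≡nCj n (suc j)) (∑𝟙[ones≡j]≡nCj n j) ⟩
  + (n C suc j) ℤ.+ + (n C j)  ≡⟨ ℤ.pos-+ (n C suc j) (n C j) ⟨
  + (n C suc j + n C j)        ≡⟨ cong +_ (+-comm (n C suc j) (n C j)) ⟩
  + (n C j + n C suc j)        ≡⟨ cong +_ (nCk+nC[k+1]≡[n+1]C[k+1] n j) ⟩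
  + (suc n C suc j)            ∎
  where open ≡-Reasoning

indicator-maj : ∀ {n q} → 2 * q ≤ n → n ≤ 1 + 2 * q → ∀ o → indicator (maj (suc n) o) ≡ 𝟙 (does (o ≤? q))
indicator-maj {n} {q} lo hi o with o ≤? q
... | yes o≤q = trans (cong indicator (maj-≰ λ 1+n≤2o → 1+n≰n (≤-trans 1+n≤2o (≤-trans (*-monoʳ-≤ 2 o≤q) lo))))
                    (cong 𝟙 (sym (dec-true (o ≤? q) o≤q)))
... | no  o≰q = trans (cong indicator (maj-≤ 1+n≤2o)) (cong 𝟙 (sym (dec-false (o ≤? q) o≰q)))
  where
  1+n≤2o : suc n ≤ 2 * o
  1+n≤2o = begin
    suc n        ≤⟨ s≤s hi ⟩
    2 + 2 * q    ≡⟨ *-suc 2 q ⟨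
    2 * suc q    ≤⟨ *-monoʳ-≤ 2 (≰⇒> o≰q) ⟩
    2 * o        ∎
    where open ≤-Reasoning

𝟙[≤]-𝟙[<]≡𝟙[≡] : ∀ o q → 𝟙 (does (o ≤? q)) ℤ.- 𝟙 (does (suc o ≤? q)) ≡ 𝟙 (does (o ≟ q))
𝟙[≤]-𝟙[<]≡𝟙[≡] o q with <-cmp o q
... | tri< o<q _ _
  rewrite dec-true (o ≤? q) (<⇒≤ o<q) | dec-true (suc o ≤? q) o<q | dec-false (o ≟ q) (<⇒≢ o<q) = refl
... | tri≈ _ refl _
  rewrite dec-true (o ≤? o) ≤-refl | dec-false (suc o ≤? o) 1+n≰n | dec-true (o ≟ o) refl = refl
... | tri> _ _ q<o
  rewrite dec-false (o ≤? q) (<⇒≱ q<o) | dec-false (suc o ≤? q) (<⇒≱ (≤-trans q<o (n≤1+n o)))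
        | dec-false (o ≟ q) (≢-sym (<⇒≢ q<o)) = refl

correlation-MAJ : ∀ {n q} → 2 * q ≤ n → n ≤ 1 + 2 * q → correlation (MAJ (suc n)) ⁅ zero ⁆ ≡ + (n C q)
correlation-MAJ {n} {q} lo hi = begin
  ∑ (λ y → F false y) ℤ.+ ∑ (λ y → F true y)  ≡⟨ ∑-+ (F false) (F true) ⟨
  ∑ (λ y → F false y ℤ.+ F true y)            ≡⟨ ∑-cong pointwise ⟩
  ∑ {n} (λ y → 𝟙 (does (ones y ≟ q)))
    ≡⟨ ∑𝟙[ones≡j]≡nCj n q ⟩
  + (n C q) ∎
  where
  open ≡-Reasoning
  F : Bool → Input n → ℤ
  F b y = indicator (MAJ (suc n) (b ∷ y)) ℤ.* χ ⁅ zero ⁆ (b ∷ y)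
  difference : ∀ a b → a ℤ.* 1ℤ ℤ.+ b ℤ.* -1ℤ ≡ a ℤ.- b
  difference = ℤ-Solver.solve-∀
  pointwise : ∀ y → F false y ℤ.+ F true y ≡ 𝟙 (does (ones y ≟ q))
  pointwise y rewrite parity-∅ y | MAJ≡maj (suc n) (false ∷ y) | MAJ≡maj (suc n) (true ∷ y)
                    | indicator-maj {n} {q} lo hi (ones y) | indicator-maj {n} {q} lo hi (suc (ones y)) =
    trans (difference (𝟙 (does (ones y ≤? q))) (𝟙 (does (suc (ones y) ≤? q)))) (𝟙[≤]-𝟙[<]≡𝟙[≡] (ones y) q)

depth-lower-bound : ∀ n (t : PDT (suc n)) → Computes t (MAJ (suc n)) → suc n ∸ B (suc n) + 1 ≤ depth t
depth-lower-bound n t computes with suc n ∸ B (suc n) + 1 ≤? depth t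
... | yes bound = bound
... | no  short = ⊥-elim (¬2^B∣binomial n q split (∣-trans (^-monoʳ-∣ 2 B≤N∸d) divisible))
  where
  N = suc n
  d = depth t
  q = proj₁ (even⊎odd n)
  split = proj₂ (even⊎odd n)
  lo : 2 * q ≤ n
  lo = [ ≤-reflexive ∘ sym , (λ e → ≤-trans (n≤1+n _) (≤-reflexive (sym e))) ]′ split
  hi : n ≤ 1 + 2 * q
  hi = [ (λ e → ≤-trans (≤-reflexive e) (n≤1+n _)) , ≤-reflexive ]′ split
  divisible : 2 ^ (N ∸ d) ∣ n C q
  divisible = ℤ.∣⇒∣ᵤ (subst (+ (2 ^ (N ∸ d)) ℤ.∣_)
    (trans (∑-cong (λ x → cong (λ o → indicator o ℤ.* χ ⁅ zero ⁆ x) (computes x))) (correlation-MAJ {n} {q} lo hi))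
    (2^[n∸depth]∣correlation t ⁅ zero ⁆))
  d≤N∸B : d ≤ N ∸ B N
  d≤N∸B = s≤s⁻¹ (subst (suc d ≤_) (+-comm (N ∸ B N) 1) (≰⇒> short))
  B≤N∸d : B N ≤ N ∸ d
  B≤N∸d = m+n≤o⇒m≤o∸n (B N) (subst (_≤ N) (+-comm d (B N)) (m≤o∸n⇒m+n≤o d (Bn≤n N) d≤N∸B))

theorem10 : ∀ (n : ℕ) → 1 ≤ n → ParityDTDepthIs (MAJ n) (n ∸ B n + 1)
theorem10 (suc n) _ =
  ( majorityTree (suc n)
  , majorityTree-correct (suc n)
  , ≤-antisym (majorityTree-depth (suc n)) (depth-lower-bound n _ (majorityTree-correct (suc n))) )
  , depth-lower-bound n
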